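{- Consider a run of the algorithm StochasticSort (defined in the context). Fix a vertex $v$ that has not been discovered yet and a level index $i$, and suppose that at some point, for all undiscovered $u\prec v$, we have $(u,v)\notin\bigcup_{j\ge i}E_j$. Then, at that point, $v$ is in level $L_i$.
   Context: Stochastic generalized sorting: there are $n$ vertices $V$ with an unknown true order $x_1 \prec \cdots \prec x_n$. The undirected graph $G=(V,E)$ is given: each pair $(x_i,x_{i+1})$ is an edge, and every other pair is an edge independently with probability $p$. A query of an edge $(u,v)\in E$ reveals which of $u,v$ comes first; only edges of $E$ may be queried. Vertices $x_1,\dots,x_\ell$ already identified are "discovered". Edge sets: $q=\Theta(\log(pn))$ is a positive integer depending only on $n,p$; $\alpha\in[1,2]$ solves $\prod_{i=1}^q (1-\alpha p/2^i) = 1-p$; for each edge $e\in E$ independently, draw independent $X_i\sim$ Bernoulli$(\alpha p/2^i)$, $i\le q$, conditioned on some $X_i=1$, and put $e\in E_i$ iff $X_i=1$. Algorithm StochasticSort: $c$ is a sufficiently large constant, $s_i=2^i/p$. Levels $L_1\subseteq\cdots\subseteq L_{q+c}$ are sets of undiscovered vertices; $L_{q+1},\dots,L_{q+c}$ contain all undiscovered vertices. Rule for building $L_i$ from $L_{i+1}$: $v\in L_{i+1}$ is excluded from $L_i$ ("blocked by the edge $(u,v)$") iff some $u\in L_{i+c}$ has $(u,v)\in E_i$ and $u\prec v$ (determined by querying); otherwise $v\in L_i$. Initially levels are built top-down by this rule. After each discovery of $x_\ell$: remove $x_\ell$ from all levels; for each $v$ currently blocked by an edge $(x_\ell,v)$,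 say $v\in L_{j+1}\setminus L_j$, repeatedly: if no $u\in L_{j+c}$ has $(u,v)\in E_j$ and $u\prec v$, add $v$ to $L_j$ and continue with $j-1$, stopping when $v\in L_1$ or when $v$ is blocked by a new edge; then, for every $i$ with $\ell$ a multiple of $s_i/32$, rebuild $L_i,L_{i-1},\dots,L_1$ in order from scratch by the rule, redetermining all blockings. Next, $x_{\ell+1}$ is found: $C=\{v\in L_1:(x_\ell,v)\in E\}$; for $i=1,2,\dots$ query all edges between $L_i$ and the remaining $C$, removing $v$ from $C$ when an edge $(u,v)$ with $u\prec v$ is found; when $|C|=1$ its element is declared $x_{\ell+1}$. -}

module Defs where

open import Data.Nat using (ℕ; zero; suc; _+_; _≤_; _<_; _≡ᵇ_)
open import Data.Fin using (Fin; toℕ; _≟_)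
open import Data.Bool using (Bool; true; false; _∧_; not; if_then_else_)
open import Data.Maybe using (Maybe; just; nothing)
open import Data.Product using (Σ; ∃; _×_; _,_)
open import Data.List using (List; []; _∷_)
open import Data.List.Membership.Propositional using (_∈_)
open import Data.List.Relation.Unary.Unique.Propositional using (Unique)
open import Relation.Nullary using (¬_)
open import Relation.Nullary.Decidable using (⌊_⌋)
open import Relation.Binary.PropositionalEquality using (_≡_; _≢_)
open import Function.Bundles using (_⇔_)

-- Vertices are Fin n; the vertex with index k is x_{k+1} of the true order,
-- so  u ≺ v  iff  toℕ u < toℕ v.  After ℓ discoveries the discovered
-- vertices are exactly those with toℕ v < ℓ.
-- Edge sets: E j u v ≡ true  means  {u,v} ∈ E_j  (level j, 1 ≤ j ≤ q).
-- Levels: L k w ≡ true means w ∈ L_k (only 1 ≤ k ≤ q + c is meaningful).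
-- B w ≡ just u records that w is currently blocked by the edge (u , w).

-- Every realisation of the random edge sets satisfies these properties.
record ValidEdgeSets (n q : ℕ) (E : ℕ → Fin n → Fin n → Bool) : Set where
  field
    symmetric : ∀ j u v → E j u v ≡ E j v u
    loopless  : ∀ j u → E j u u ≡ false
    range     : ∀ j u v → E j u v ≡ true → (1 ≤ j) × (j ≤ q)
    path      : ∀ u v → toℕ v ≡ suc (toℕ u) → ∃ λ j → E j u v ≡ true

record State (n : ℕ) : Set where
  constructor st
  field
    L : ℕ → Fin n → Bool
    B : Fin n → Maybe (Fin n)

open State public

-- The algorithm, for parameters n, q, constant c, edge sets E, and a
-- rebuild schedule R : R ℓ i ≡ true iff, after the ℓ-th discovery,
-- ℓ is a multiple of s_i / 32 (so L_i, ..., L_1 are rebuilt).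
module StochasticSort (n q c : ℕ) (E : ℕ → Fin n → Fin n → Bool)
                      (R : ℕ → ℕ → Bool) where

  Blocks : (ℕ → Fin n → Bool) → ℕ → Fin n → Fin n → Set
  Blocks L j u v = (E j u v ≡ true) × (L (j + c) u ≡ true) × (toℕ u < toℕ v)

  Blocked : (ℕ → Fin n → Bool) → ℕ → Fin n → Set
  Blocked L j v = ∃ λ u → Blocks L j u v

  addTo : ℕ → Fin n → State n → State n
  addTo j v S = st (λ k w → if (k ≡ᵇ j) ∧ ⌊ w ≟ v ⌋ then true else L S k w) (B S)

  setB : Fin n → Fin n → State n → State n
  setB v u S = st (L S) (λ w → if ⌊ w ≟ v ⌋ then just u else B S w)

  removeV : Fin n → State n → State n
  removeV d S = st (λ k w → L S k w ∧ not ⌊ d ≟ w ⌋) (B S)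

  -- Building L_j from L_{j+1} by the rule (blockings redetermined,
  -- with a nondeterministic choice of the blocking edge).
  record RebuildLevel (j : ℕ) (S S' : State n) : Set where
    field
      others    : ∀ k → k ≢ j → L S' k ≡ L S k
      rule      : ∀ v → (L S' j v ≡ true) ⇔ ((L S (suc j) v ≡ true) × ¬ Blocked (L S) j v)
      blocker   : ∀ v → L S (suc j) v ≡ true → Blocked (L S) j v →
                  ∃ λ u → Blocks (L S) j u v × (B S' v ≡ just u)
      keepB     : ∀ v → ¬ ((L S (suc j) v ≡ true) × Blocked (L S) j v) → B S' v ≡ B S v

  data RebuildDown : ℕ → State n → State n → Set where
    rd-zero : ∀ {S} → RebuildDown zero S S
    rd-suc  : ∀ {j S S' S''} → RebuildLevel (suc j) S S' → RebuildDown j S' S'' →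
              RebuildDown (suc j) S S''

  -- Fix j v S S' : v ∈ L_{j+1} \ L_j ; test whether v can be added to L_j.
  -- (Fix zero: v has reached L_1.)
  data Fix : ℕ → Fin n → State n → State n → Set where
    fix-done    : ∀ {v S} → Fix zero v S S
    fix-blocked : ∀ {j u v S} → Blocks (L S) (suc j) u v → Fix (suc j) v S (setB v u S)
    fix-add     : ∀ {j v S S'} → ¬ Blocked (L S) (suc j) v →
                  Fix j v (addTo (suc j) v S) S' → Fix (suc j) v S S'

  FixVertex : Fin n → State n → State n → Set
  FixVertex v S S' = ∃ λ j → (L S (suc (suc j)) v ≡ true) × (L S (suc j) v ≡ false)
                             × Fix (suc j) v S S'

  data FixAll : List (Fin n) → State n → State n → Set where
    fa-nil  : ∀ {S} → FixAll [] S S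
    fa-cons : ∀ {v vs S S' S''} → FixVertex v S S' → FixAll vs S' S'' →
              FixAll (v ∷ vs) S S''

  data RebuildSched (ℓ : ℕ) : ℕ → State n → State n → Set where
    rs-zero : ∀ {S} → RebuildSched ℓ zero S S
    rs-yes  : ∀ {i S S' S''} → R ℓ (suc i) ≡ true → RebuildDown (suc i) S S' →
              RebuildSched ℓ i S' S'' → RebuildSched ℓ (suc i) S S''
    rs-no   : ∀ {i S S'} → R ℓ (suc i) ≡ false → RebuildSched ℓ i S S' →
              RebuildSched ℓ (suc i) S S'

  BlockedBy : ℕ → Fin n → State n → Fin n → Set
  BlockedBy ℓ d S v = (ℓ < toℕ v) × (L S 1 v ≡ false) × (B S v ≡ just d)

  -- Reach ℓ S : S is the state (levels + blockings) of a run of the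
  -- algorithm at the point where x_1..x_ℓ are discovered and the level
  -- maintenance for x_ℓ has been completed.
  data Reach : ℕ → State n → Set where
    initial : ∀ {S₀ S} → (∀ k v → q < k → L S₀ k v ≡ true) →
              RebuildDown q S₀ S → Reach zero S
    discover : ∀ {ℓ S S₂ S₃} (d : Fin n) → Reach ℓ S → toℕ d ≡ ℓ →
               (vs : List (Fin n)) → Unique vs →
               (∀ v → (v ∈ vs) ⇔ BlockedBy ℓ d (removeV d S) v) →
               FixAll vs (removeV d S) S₂ →
               RebuildSched (suc ℓ) q S₂ S₃ →
               Reach (suc ℓ) S₃

-- Every reachable state satisfies an invariant: each undiscovered v has a
-- threshold m with v ∈ L_k exactly for k > m, and if m ≥ 1 then v records a
-- blocking edge (u , v) ∈ E_m with u ≺ v and u undiscovered.  Rebuilding a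
-- level, fixing a vertex and rebuilding on schedule all preserve it; a
-- discovery of x_ℓ breaks it only for the vertices blocked by an edge from
-- x_ℓ, which are exactly the vertices the algorithm then fixes.  Given the
-- invariant, v ∉ L_i would force a blocking edge of some level m ≥ i, which
-- the hypothesis excludes.
module Submission where

open import Defs
open import Data.Nat using (ℕ; suc; _+_; _≤_; _<_; z≤n; s≤s; _≡ᵇ_; _<?_; _≤?_)
open import Data.Nat.Properties
  using ( ≡ᵇ⇒≡; ≡⇒≡ᵇ; ≤-refl; ≤-trans; ≤-antisym; ≤-<-trans; <⇒≤; <⇒≱; ≮⇒≥; ≰⇒>; ≤∧≢⇒<; ≤-pred
        ; n<1+n; n≤1+n)
  renaming (_≟_ to _≟ℕ_)
open import Data.Fin using (Fin; toℕ; _≟_)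
open import Data.Fin.Properties using (toℕ-injective; any?)
open import Data.Bool using (Bool; true; false)
import Data.Bool.Properties as Bool
open import Data.Maybe using (just)
open import Data.Product using (∃; _×_; _,_; proj₁; proj₂)
open import Data.Sum using (_⊎_; inj₁; inj₂; [_,_])
open import Data.List using (List; []; _∷_)
open import Data.List.Membership.Propositional using (_∈_)
open import Data.List.Relation.Unary.All as All using (All; _∷_)
open import Data.List.Relation.Unary.Any using (here; there)
open import Function using (_∘_; id)
open import Function.Bundles using (_⇔_; Equivalence)
open import Relation.Nullary using (¬_; Dec; yes; no; contradiction)
open import Relation.Nullary.Decidable using (_×-dec_; isYes≗does; dec-true; dec-false)
open import Relation.Binary.PropositionalEquality using (_≡_; _≢_; refl; sym; trans; cong; cong-app; subst)

open Equivalence using (to; from)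

≡ᵇ-refl : ∀ k → (k ≡ᵇ k) ≡ true
≡ᵇ-refl k = to Bool.T-≡ (≡⇒≡ᵇ k k refl)

≢⇒≡ᵇ-false : ∀ {k j} → k ≢ j → (k ≡ᵇ j) ≡ false
≢⇒≡ᵇ-false {k} {j} k≢j = Bool.¬-not (k≢j ∘ ≡ᵇ⇒≡ k j ∘ from Bool.T-≡)

module LevelInvariant (n q c : ℕ) (E : ℕ → Fin n → Fin n → Bool) (R : ℕ → ℕ → Bool) where
  open StochasticSort n q c E R

  record DiscoveredRemoved (ℓ : ℕ) (Lv : ℕ → Fin n → Bool) : Set where
    field
      absent : ∀ k w → toℕ w < ℓ → Lv k w ≡ false

  record Threshold (j m : ℕ) (Lv : ℕ → Fin n → Bool) (v : Fin n) : Set where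
    field
      member⇒above : ∀ {k} → j < k → Lv k v ≡ true → m < k
      above⇒member : ∀ {k} → j < k → m < k → Lv k v ≡ true

  record Witness (ℓ : ℕ) (S : State n) (m : ℕ) (v : Fin n) : Set where
    constructor witness
    field
      by           : Fin n
      recorded     : B S v ≡ just by
      edge         : E m by v ≡ true
      precedes     : toℕ by < toℕ v
      undiscovered : ℓ ≤ toℕ by

  Settled : ℕ → ℕ → State n → Fin n → Set
  Settled j ℓ S v = ∃ λ m → Threshold j m (L S) v × (j < m → Witness ℓ S m v)

  -- The levels above j are correct; those up to j are still to be rebuilt.
  Invariant : ℕ → ℕ → State n → Set
  Invariant j ℓ S = DiscoveredRemoved ℓ (L S) × (∀ v → ℓ ≤ toℕ v → Settled j ℓ S v)

  open DiscoveredRemoved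
  open Threshold

  member⇒undiscovered : ∀ {ℓ Lv k w} → DiscoveredRemoved ℓ Lv → Lv k w ≡ true → ℓ ≤ toℕ w
  member⇒undiscovered {k = k} {w} removed w∈ =
    ≮⇒≥ λ w<ℓ → contradiction (trans (sym w∈) (absent removed k w w<ℓ)) λ ()

  blocks⇒witness : ∀ {ℓ Lv S j u v} → DiscoveredRemoved ℓ Lv → Blocks Lv j u v →
                   B S v ≡ just u → Witness ℓ S j v
  blocks⇒witness removed (e , u∈ , u≺v) Bv = witness _ Bv e u≺v (member⇒undiscovered removed u∈)

  witness-transfer : ∀ {ℓ m S S' v} → B S' v ≡ B S v → Witness ℓ S m v → Witness ℓ S' m v
  witness-transfer same (witness u Bv e u≺v ℓ≤u) = witness u (trans same Bv) e u≺v ℓ≤u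

  threshold-transfer : ∀ {j m Lv Lv' v} → (∀ k → Lv' k v ≡ Lv k v) →
                       Threshold j m Lv v → Threshold j m Lv' v
  threshold-transfer same th .member⇒above j<k = member⇒above th j<k ∘ trans (sym (same _))
  threshold-transfer same th .above⇒member j<k = trans (same _) ∘ above⇒member th j<k

  threshold-mono : ∀ {i j m Lv v} → i ≤ j → Threshold i m Lv v → Threshold j m Lv v
  threshold-mono i≤j th .member⇒above j<k = member⇒above th (≤-<-trans i≤j j<k)
  threshold-mono i≤j th .above⇒member j<k = above⇒member th (≤-<-trans i≤j j<k)

  threshold-unique : ∀ {j m Lv v} → Threshold 0 m Lv v →
                     Lv (suc (suc j)) v ≡ true → Lv (suc j) v ≡ false → m ≡ suc j
  threshold-unique th v∈ v∉ = ≤-antisym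
    (≤-pred (member⇒above th (s≤s z≤n) v∈))
    (≮⇒≥ λ m<sj → contradiction (trans (sym (above⇒member th (s≤s z≤n) m<sj)) v∉) λ ())

  threshold-step : ∀ {j m m' Lv Lv' v} → (∀ k → k ≢ suc j → Lv' k v ≡ Lv k v) →
                   (∀ {k} → suc j < k → (m < k → m' < k) × (m' < k → m < k)) →
                   (Lv' (suc j) v ≡ true → m' < suc j) → (m' < suc j → Lv' (suc j) v ≡ true) →
                   Threshold (suc j) m Lv v → Threshold j m' Lv' v
  threshold-step {j} unchanged agree out into th .member⇒above {k} j<k with k ≟ℕ suc j
  ... | yes refl = out
  ... | no k≢sj = proj₁ (agree sj<k) ∘ member⇒above th sj<k ∘ trans (sym (unchanged k k≢sj))
    where sj<k = ≤∧≢⇒< j<k (k≢sj ∘ sym)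
  threshold-step {j} unchanged agree out into th .above⇒member {k} j<k with k ≟ℕ suc j
  ... | yes refl = into
  ... | no k≢sj = trans (unchanged k k≢sj) ∘ above⇒member th sj<k ∘ proj₂ (agree sj<k)
    where sj<k = ≤∧≢⇒< j<k (k≢sj ∘ sym)

  both-below : ∀ {j m m'} → m ≤ suc j → m' ≤ suc j →
               ∀ {k} → suc j < k → (m < k → m' < k) × (m' < k → m < k)
  both-below m≤ m'≤ sj<k = (λ _ → ≤-<-trans m'≤ sj<k) , (λ _ → ≤-<-trans m≤ sj<k)

  blocked? : ∀ Lf j v → Dec (Blocked Lf j v)
  blocked? Lf j v =
    any? λ u → (E j u v Bool.≟ true) ×-dec ((Lf (j + c) u Bool.≟ true) ×-dec (toℕ u <? toℕ v))

  module _ {j S S'} (rebuild : RebuildLevel (suc j) S S') where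
    open RebuildLevel rebuild

    unchanged : ∀ w k → k ≢ suc j → L S' k w ≡ L S k w
    unchanged w k k≢ = cong-app (others k k≢) w

    rebuildLevel-removed : ∀ {ℓ} → DiscoveredRemoved ℓ (L S) → DiscoveredRemoved ℓ (L S')
    rebuildLevel-removed removed .absent k w w<ℓ with k ≟ℕ suc j
    ... | yes refl = Bool.¬-not λ w∈ →
          contradiction (trans (sym (proj₁ (to (rule w) w∈))) (absent removed _ w w<ℓ)) λ ()
    ... | no k≢ = trans (unchanged w k k≢) (absent removed k w w<ℓ)

    rebuildLevel-settled : ∀ {ℓ v} → DiscoveredRemoved ℓ (L S) →
                           Settled (suc j) ℓ S v → Settled j ℓ S' v
    rebuildLevel-settled {v = v} removed (m , th , wit) with suc j <? m
    ... | yes sj<m = m , threshold-step (unchanged v) (λ _ → id , id) out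
                           (λ m<sj → contradiction (<⇒≤ m<sj) (<⇒≱ sj<m)) th ,
                         λ _ → witness-transfer (keepB v (v∉ ∘ proj₁)) (wit sj<m)
      where
        v∉ : ¬ L S (suc (suc j)) v ≡ true
        v∉ = <⇒≱ sj<m ∘ ≤-pred ∘ member⇒above th ≤-refl
        out : L S' (suc j) v ≡ true → m < suc j
        out v∈' = contradiction (proj₁ (to (rule v) v∈')) v∉
    ... | no sj≮m with ≮⇒≥ sj≮m
    ...   | m≤sj with above⇒member th ≤-refl (s≤s m≤sj) | blocked? (L S) (suc j) v
    ...     | v∈ | yes blocked = suc j , threshold-step (unchanged v) (both-below m≤sj ≤-refl)
                (contradiction blocked ∘ proj₂ ∘ to (rule v)) (contradiction ≤-refl ∘ <⇒≱) th , found
      where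
        found : j < suc j → Witness _ S' (suc j) v
        found _ with blocker v v∈ blocked
        ... | u , blocks , Bv = blocks⇒witness removed blocks Bv
    ...     | v∈ | no unblocked = j , threshold-step (unchanged v) (both-below m≤sj (n≤1+n j))
                (λ _ → n<1+n j) (λ _ → from (rule v) (v∈ , unblocked)) th ,
                contradiction ≤-refl ∘ <⇒≱

    rebuildLevel-invariant : ∀ {ℓ} → Invariant (suc j) ℓ S → Invariant j ℓ S'
    rebuildLevel-invariant (removed , settled) =
      rebuildLevel-removed removed , λ v v-undisc → rebuildLevel-settled removed (settled v v-undisc)

  rebuildDown-invariant : ∀ {j ℓ S S'} → RebuildDown j S S' → Invariant j ℓ S → Invariant 0 ℓ S'
  rebuildDown-invariant rd-zero inv = inv
  rebuildDown-invariant (rd-suc rebuild rd) inv =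
    rebuildDown-invariant rd (rebuildLevel-invariant rebuild inv)

  invariant-mono : ∀ {j ℓ S} → Invariant 0 ℓ S → Invariant j ℓ S
  invariant-mono (removed , settled) = removed , λ v v-undisc →
    let (m , th , wit) = settled v v-undisc in m , threshold-mono z≤n th , wit ∘ ≤-<-trans z≤n

  rebuildSched-invariant : ∀ {ℓ' i ℓ S S'} → RebuildSched ℓ' i S S' →
                           Invariant 0 ℓ S → Invariant 0 ℓ S'
  rebuildSched-invariant rs-zero inv = inv
  rebuildSched-invariant (rs-yes _ rd rs) inv =
    rebuildSched-invariant rs (rebuildDown-invariant rd (invariant-mono inv))
  rebuildSched-invariant (rs-no _ rs) inv = rebuildSched-invariant rs inv

  addTo-self : ∀ j v S → L (addTo j v S) j v ≡ true
  addTo-self j v S rewrite ≡ᵇ-refl j | isYes≗does (v ≟ v) | dec-true (v ≟ v) refl = refl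

  addTo-level : ∀ {j k} v S → k ≢ j → L (addTo j v S) k v ≡ L S k v
  addTo-level v S k≢j rewrite ≢⇒≡ᵇ-false k≢j = refl

  addTo-vertex : ∀ j {v w} S k → w ≢ v → L (addTo j v S) k w ≡ L S k w
  addTo-vertex j {v} {w} S k w≢v
    rewrite isYes≗does (w ≟ v) | dec-false (w ≟ v) w≢v | Bool.∧-zeroʳ (k ≡ᵇ j) = refl

  setB-self : ∀ v u S → B (setB v u S) v ≡ just u
  setB-self v u S rewrite isYes≗does (v ≟ v) | dec-true (v ≟ v) refl = refl

  setB-vertex : ∀ {v w} u S → w ≢ v → B (setB v u S) w ≡ B S w
  setB-vertex {v} {w} u S w≢v rewrite isYes≗does (w ≟ v) | dec-false (w ≟ v) w≢v = refl

  removeV-self : ∀ {d} S k → L (removeV d S) k d ≡ false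
  removeV-self {d} S k rewrite isYes≗does (d ≟ d) | dec-true (d ≟ d) refl = Bool.∧-zeroʳ _

  removeV-vertex : ∀ {d w} S k → d ≢ w → L (removeV d S) k w ≡ L S k w
  removeV-vertex {d} {w} S k d≢w
    rewrite isYes≗does (d ≟ w) | dec-false (d ≟ w) d≢w = Bool.∧-identityʳ _

  AgreeExcept : Fin n → State n → State n → Set
  AgreeExcept v S S' = ∀ w → w ≢ v → (∀ k → L S' k w ≡ L S k w) × (B S' w ≡ B S w)

  threshold-addTo : ∀ {j v S} → Threshold 0 (suc j) (L S) v →
                    Threshold 0 j (L (addTo (suc j) v S)) v
  threshold-addTo {j} {v} {S} th .member⇒above {k} 0<k with k ≟ℕ suc j
  ... | yes refl = λ _ → n<1+n j
  ... | no k≢sj = <⇒≤ ∘ member⇒above th 0<k ∘ trans (sym (addTo-level v S k≢sj))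
  threshold-addTo {j} {v} {S} th .above⇒member {k} 0<k with k ≟ℕ suc j
  ... | yes refl = λ _ → addTo-self (suc j) v S
  ... | no k≢sj =
    trans (addTo-level v S k≢sj) ∘ above⇒member th 0<k ∘ λ j<k → ≤∧≢⇒< j<k (k≢sj ∘ sym)

  fix-settles : ∀ {j v ℓ S S'} → Fix j v S S' →
                DiscoveredRemoved ℓ (L S) → ℓ ≤ toℕ v → Threshold 0 j (L S) v →
                DiscoveredRemoved ℓ (L S') × Settled 0 ℓ S' v × AgreeExcept v S S'
  fix-settles fix-done removed _ th = removed , (0 , th , λ ()) , λ _ _ → (λ _ → refl) , refl
  fix-settles {v = v} {S = S} (fix-blocked {u = u} blocks) removed _ th =
    removed , (_ , th , λ _ → blocks⇒witness removed blocks (setB-self v u S)) ,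
    λ w w≢v → (λ _ → refl) , setB-vertex u S w≢v
  fix-settles {suc j} {v} {ℓ} {S} (fix-add _ fix) removed v-undisc th
    with fix-settles fix removed' v-undisc (threshold-addTo {S = S} th)
    where
      removed' : DiscoveredRemoved ℓ (L (addTo (suc j) v S))
      removed' .absent k w w<ℓ =
        trans (addTo-vertex (suc j) S k (λ { refl → <⇒≱ w<ℓ v-undisc })) (absent removed k w w<ℓ)
  ... | removed'' , settled , agree = removed'' , settled , λ w w≢v →
          (λ k → trans (proj₁ (agree w w≢v) k) (addTo-vertex (suc j) S k w≢v)) , proj₂ (agree w w≢v)

  -- While the blocked vertices vs are being fixed, they are exempt from Settled.
  SettledOrIn : List (Fin n) → ℕ → State n → Fin n → Set
  SettledOrIn vs ℓ S v = ∃ λ m → Threshold 0 m (L S) v × (0 < m → Witness ℓ S m v ⊎ v ∈ vs)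

  Pending : ℕ → List (Fin n) → State n → Set
  Pending ℓ vs S = DiscoveredRemoved ℓ (L S) × All (λ v → ℓ ≤ toℕ v) vs ×
                   (∀ v → ℓ ≤ toℕ v → SettledOrIn vs ℓ S v)

  settledOrIn-transfer : ∀ {v vs ℓ S S' w} → AgreeExcept v S S' → w ≢ v →
                         SettledOrIn (v ∷ vs) ℓ S w → SettledOrIn vs ℓ S' w
  settledOrIn-transfer agree w≢v (m , th , witness-or-in) with agree _ w≢v
  ... | sameL , sameB = m , threshold-transfer sameL th , shift ∘ witness-or-in
    where
      shift : Witness _ _ m _ ⊎ _ ∈ (_ ∷ _) → Witness _ _ m _ ⊎ _ ∈ _
      shift (inj₁ wit) = inj₁ (witness-transfer sameB wit)
      shift (inj₂ (here w≡v)) = contradiction w≡v w≢v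
      shift (inj₂ (there w∈)) = inj₂ w∈

  settledOrIn-[] : ∀ {ℓ S v} → SettledOrIn [] ℓ S v → Settled 0 ℓ S v
  settledOrIn-[] (m , th , witness-or-in) = m , th , [ id , (λ ()) ] ∘ witness-or-in

  fixAll-invariant : ∀ {ℓ vs S S'} → FixAll vs S S' → Pending ℓ vs S → Invariant 0 ℓ S'
  fixAll-invariant fa-nil (removed , _ , pending) =
    removed , λ v v-undisc → settledOrIn-[] (pending v v-undisc)
  fixAll-invariant {ℓ} {S = S} (fa-cons {v = v} {vs} {S' = S₁} (j , v∈ , v∉ , fix) fa)
                   (removed , v-undisc ∷ undisc , pending)
    with pending v v-undisc
  ... | m , th , _ with fix-settles fix removed v-undisc
                          (subst (λ m → Threshold 0 m (L S) v) (threshold-unique th v∈ v∉) th)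
  ...   | removed' , (m' , th' , witness') , agree = fixAll-invariant fa (removed' , undisc , pending')
    where
      pending' : ∀ w → ℓ ≤ toℕ w → SettledOrIn vs ℓ S₁ w
      pending' w w-undisc with w ≟ v
      ... | yes refl = m' , th' , inj₁ ∘ witness'
      ... | no w≢v = settledOrIn-transfer agree w≢v (pending w w-undisc)

  discovery-removed : ∀ {ℓ S d} → DiscoveredRemoved ℓ (L S) → toℕ d ≡ ℓ →
                      DiscoveredRemoved (suc ℓ) (L (removeV d S))
  discovery-removed {ℓ} {S} {d} removed d≡ℓ .absent k w w≤ℓ with toℕ w <? ℓ
  ... | yes w<ℓ rewrite absent removed k w w<ℓ = refl
  ... | no w≮ℓ with toℕ-injective {i = d} (trans d≡ℓ (≤-antisym (≮⇒≥ w≮ℓ) (≤-pred w≤ℓ)))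
  ...   | refl = removeV-self S k

  -- A witness u that is still undiscovered remains valid; otherwise u = x_ℓ
  -- and v is one of the vertices the algorithm is about to fix.
  discovery-pending : ∀ {ℓ S} d → Invariant 0 ℓ S → toℕ d ≡ ℓ → (vs : List (Fin n)) →
                      (∀ v → (v ∈ vs) ⇔ BlockedBy ℓ d (removeV d S) v) →
                      Pending (suc ℓ) vs (removeV d S)
  discovery-pending {ℓ} {S} d (removed , settled) d≡ℓ vs blocked-by =
    discovery-removed {S = S} removed d≡ℓ , All.tabulate (proj₁ ∘ to (blocked-by _)) , pending
    where
      pending : ∀ v → suc ℓ ≤ toℕ v → SettledOrIn vs (suc ℓ) (removeV d S) v
      pending v ℓ<v with settled v (<⇒≤ ℓ<v)
      ... | m , th , wit = m , threshold-transfer same th , reclassify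
        where
          same : ∀ k → L (removeV d S) k v ≡ L S k v
          same k = removeV-vertex S k λ { refl → <⇒≱ ℓ<v (subst (_≤ ℓ) (sym d≡ℓ) ≤-refl) }
          reclassify : 0 < m → Witness (suc ℓ) (removeV d S) m v ⊎ v ∈ vs
          reclassify 0<m with wit 0<m
          ... | witness u Bv e u≺v ℓ≤u with suc ℓ ≤? toℕ u
          ...   | yes ℓ<u = inj₁ (witness u Bv e u≺v ℓ<u)
          ...   | no ℓ≮u = inj₂ (from (blocked-by v) (ℓ<v , v∉L₁ , trans Bv (cong just u≡d)))
            where
              u≡d : u ≡ d
              u≡d = toℕ-injective (trans (≤-antisym (≤-pred (≰⇒> ℓ≮u)) ℓ≤u) (sym d≡ℓ))
              v∉L₁ : L (removeV d S) 1 v ≡ false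
              v∉L₁ = trans (same 1) (Bool.¬-not (<⇒≱ 0<m ∘ ≤-pred ∘ member⇒above th (s≤s z≤n)))

  initial-invariant : ∀ {S} → (∀ k v → q < k → L S k v ≡ true) → Invariant q 0 S
  initial-invariant full = record { absent = λ _ _ () } , λ v _ →
    q , record { member⇒above = λ q<k _ → q<k ; above⇒member = λ q<k _ → full _ v q<k } ,
    contradiction ≤-refl ∘ <⇒≱

  reach-invariant : ∀ {ℓ S} → Reach ℓ S → Invariant 0 ℓ S
  reach-invariant (initial full rd) = rebuildDown-invariant rd (initial-invariant full)
  reach-invariant (discover d reached d≡ℓ vs _ blocked-by fa rs) =
    rebuildSched-invariant rs
      (fixAll-invariant fa (discovery-pending d (reach-invariant reached) d≡ℓ vs blocked-by))

  member-unless-blocked : ∀ {ℓ S v i} → Settled 0 ℓ S v → 1 ≤ i →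
    (∀ u → ℓ ≤ toℕ u → toℕ u < toℕ v → ∀ j → i ≤ j → E j u v ≡ false) → L S i v ≡ true
  member-unless-blocked {i = i} (m , th , wit) 1≤i no-edge with m <? i
  ... | yes m<i = above⇒member th 1≤i m<i
  ... | no m≮i with wit (≤-trans 1≤i (≮⇒≥ m≮i))
  ...   | witness u _ e u≺v ℓ≤u =
    contradiction (trans (sym e) (no-edge u ℓ≤u u≺v _ (≮⇒≥ m≮i))) λ ()

-- The invariant holds for arbitrary edge sets.
proposition3 : (n q c : ℕ) → 1 ≤ c →
    (E : ℕ → Fin n → Fin n → Bool) → ValidEdgeSets n q E →
    (R : ℕ → ℕ → Bool) →
    (ℓ : ℕ) (S : State n) → StochasticSort.Reach n q c E R ℓ S →
    (v : Fin n) → ℓ ≤ toℕ v →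
    (i : ℕ) → 1 ≤ i → i ≤ q + c →
    (∀ (u : Fin n) → ℓ ≤ toℕ u → toℕ u < toℕ v → ∀ (j : ℕ) → i ≤ j → E j u v ≡ false) →
    L S i v ≡ true
proposition3 n q c _ E _ R ℓ S reached v v-undiscovered i 1≤i _ no-edge =
  member-unless-blocked (proj₂ (reach-invariant reached) v v-undiscovered) 1≤i no-edge
  where open LevelInvariant n q c E R
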